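{- Let $G$ be a binary quasigroup of order $n$ with the right inverse-property. Then every equivalence class of tuples has period $1$ or $2$.
   Context: Let $\mathcal I_n=\{1,\dots,n\}$. A binary quasigroup $G$ of order $n$ is the set $\mathcal I_n$ with an operation $*$ such that for all $a_0,a_1,a_2$ there are unique $x_1,x_2$ with $a_1*x_2=a_0$ and $x_1*a_2=a_0$. $G$ has the right inverse-property if there is a permutation $\pi$ of $G$ with $(g*h)*\pi(h)=g$ for all $g,h$. Elements of $\mathcal I_n^n$ are tuples; $*$ acts on tuples entrywise. A permutation (tuple) is a tuple with pairwise distinct entries; $\mathcal W$ is the set of them. For $d\ge0$, a $U$-diagonal of type $V$ in $G[d]$ is a sequence $(W_1,\dots,W_d)\in\mathcal W^d$ with $(\cdots((U*W_1)*W_2)*\cdots)*W_d=V$ entrywise. Tuples $U,V$ are equivalent if for some $d\ge0$ there is a $U$-diagonal of type $V$ in $G[d]$; the classes are the equivalence classes. The period of a class $\mathcal U$ is the gcd of all $d\ge1$ such that some $U\in\mathcal U$ admits a $U$-diagonal of type $U$ in $G[d]$. -}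

module Defs where

open import Data.Nat using (ℕ; zero; suc; _≥_)
open import Data.Nat.Divisibility using (_∣_)
open import Data.Fin using (Fin)
open import Data.Fin.Permutation using (Permutation′; _⟨$⟩ʳ_)
open import Data.Vec using (Vec; zipWith; map)
open import Data.Vec.Relation.Unary.Unique.Propositional using (Unique)
open import Data.Product using (Σ; ∃; ∃-syntax; _×_)
open import Relation.Binary.PropositionalEquality using (_≡_)

∃!′ : {A : Set} → (A → Set) → Set
∃!′ {A} P = Σ A λ x → P x × (∀ y → P y → y ≡ x)

IsQuasigroup : (n : ℕ) → (Fin n → Fin n → Fin n) → Set
IsQuasigroup n _*_ =
  (∀ a₀ a₁ → ∃!′ λ x₂ → a₁ * x₂ ≡ a₀) ×
  (∀ a₀ a₂ → ∃!′ λ x₁ → x₁ * a₂ ≡ a₀)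

HasRightInverseProperty : (n : ℕ) → (Fin n → Fin n → Fin n) → Set
HasRightInverseProperty n _*_ =
  Σ (Permutation′ n) λ π → ∀ g h → (g * h) * (π ⟨$⟩ʳ h) ≡ g

Tuple : ℕ → Set
Tuple n = Vec (Fin n) n

_⊛[_]_ : {n : ℕ} → Tuple n → (Fin n → Fin n → Fin n) → Tuple n → Tuple n
U ⊛[ _*_ ] W = zipWith _*_ U W

IsPermTuple : {n : ℕ} → Tuple n → Set
IsPermTuple W = Unique W

data Diagonal {n : ℕ} (_*_ : Fin n → Fin n → Fin n) (U : Tuple n) : ℕ → Tuple n → Set where
  []  : Diagonal _*_ U zero U
  _▷_∣_ : ∀ {d V} → Diagonal _*_ U d V → (W : Tuple n) → IsPermTuple W →
          Diagonal _*_ U (suc d) (V ⊛[ _*_ ] W)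

Equivalent : {n : ℕ} → (Fin n → Fin n → Fin n) → Tuple n → Tuple n → Set
Equivalent _*_ U V = ∃[ d ] Diagonal _*_ U d V

ReturnLength : {n : ℕ} → (Fin n → Fin n → Fin n) → Tuple n → ℕ → Set
ReturnLength _*_ U d = d ≥ 1 × ∃[ U′ ] (Equivalent _*_ U U′ × Diagonal _*_ U′ d U′)

IsGcdOf : (ℕ → Set) → ℕ → Set
IsGcdOf S g = (∀ d → S d → g ∣ d) × (∀ c → (∀ d → S d → c ∣ d) → c ∣ g)

HasPeriod : {n : ℕ} → (Fin n → Fin n → Fin n) → Tuple n → ℕ → Set
HasPeriod _*_ U p = IsGcdOf (ReturnLength _*_ U) p

module Submission where

open import Defs
open import Data.Nat using (ℕ)
open import Data.Fin using (Fin)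
open import Data.Product using (∃-syntax; _×_)
open import Data.Sum using (_⊎_)
open import Relation.Binary.PropositionalEquality using (_≡_)

open import Data.Nat using (zero; suc; _+_; _≤_; _<_; s≤s; z≤n; parity)
import Data.Nat.Properties as ℕ
open import Data.Nat.Divisibility using (_∣_; _∣0; 1∣_; n∣n; ∣m∣n⇒∣m+n; ∣m+n∣m⇒∣n)
open import Data.Parity using (Parity; 0ℙ; 1ℙ; _⁻¹) renaming (_+_ to _+ℙ_)
import Data.Parity.Properties as ℙ
open import Data.Fin.Base using (zero; suc)
import Data.Fin.Properties as Fin
open import Data.Fin.Permutation using (Permutation′; _⟨$⟩ʳ_)
open import Function.Bundles using (Injection)
open import Function.Properties.Inverse using (↔⇒↣)
open import Data.Vec.Base using (Vec; []; _∷_; zipWith; map; allFin)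
import Data.Vec.Properties as Vec
open import Data.Vec.Relation.Unary.Unique.Propositional.Properties using (map⁺; tabulate⁺)
open import Data.Vec.Relation.Unary.AllPairs using (allPairs?)
open import Data.List.Base as List using (List; []; _∷_; length; lookup; cartesianProduct; cartesianProductWith)
open import Data.List.Membership.Propositional using (_∈_)
open import Data.List.Membership.Propositional.Properties
  using (∈-allFin; ∈-lookup; ∈-cartesianProduct⁺; ∈-cartesianProductWith⁺)
open import Data.List.Membership.Setoid.Properties using (index-injective)
import Data.List.Membership.DecPropositional as DecMembership
open import Data.List.Relation.Binary.Subset.Propositional using (_⊆_)
import Data.List.Relation.Unary.All as All
open import Data.List.Relation.Unary.All.Properties using (¬Any⇒All¬)
open import Data.List.Relation.Unary.Any as Any using (here; there)
open import Data.List.Relation.Unary.AllPairs using ([]; _∷_)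
open import Data.List.Relation.Unary.Unique.Propositional as UniqueList using ()
open import Data.Product using (Σ; ∃; _,_)
import Data.Product.Properties as Product
open import Data.Sum using (inj₁; inj₂)
open import Data.Empty using (⊥-elim)
open import Relation.Binary.Definitions using (DecidableEquality)
open import Relation.Binary.PropositionalEquality
  using (refl; sym; trans; cong; cong₂; subst; setoid; module ≡-Reasoning)
open import Relation.Nullary using (Dec; yes; no; ¬_; ¬?; _×-dec_; map′)

-- The right inverse-property lets a step U ↦ U * W be undone by the step
-- U * W ↦ (U * W) * π(W), and π(W) is again a permutation tuple.  Hence diagonals
-- can be reversed, every U returns to itself in two steps (via the identity
-- tuple), and a return cycle of length d at any U′ equivalent to U, conjugated
-- by a diagonal U → U′ and its reverse, becomes a closed diagonal at U of the
-- same parity as d.  So the period is 1 if U has a closed diagonal of odd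
-- length and 2 otherwise.  Which case holds is decidable: it asks whether
-- (U, even) reaches (U, odd) in the parity double cover of the step graph, a
-- graph on the finite set of tuples, where a walk can always be shortened to
-- one with fewer steps than there are vertices.

record Enumeration (A : Set) : Set where
  field
    elements : List A
    complete : ∀ x → x ∈ elements

open Enumeration

∃? : ∀ {A : Set} {P : A → Set} → Enumeration A → (∀ x → Dec (P x)) → Dec (∃ P)
∃? enum P? = map′ Any.satisfied (λ (x , px) → Any.map (λ { refl → px }) (complete enum x))
                  (Any.any? P? (elements enum))

finEnumeration : ∀ n → Enumeration (Fin n)
finEnumeration n = record { elements = List.allFin n ; complete = ∈-allFin }

parityEnumeration : Enumeration Parity
parityEnumeration = record
  { elements = 0ℙ ∷ 1ℙ ∷ []
  ; complete = λ { 0ℙ → here refl ; 1ℙ → there (here refl) } }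

×-enumeration : ∀ {A B : Set} → Enumeration A → Enumeration B → Enumeration (A × B)
×-enumeration enumA enumB = record
  { elements = cartesianProduct (elements enumA) (elements enumB)
  ; complete = λ (a , b) → ∈-cartesianProduct⁺ (complete enumA a) (complete enumB b) }

vecEnumeration : ∀ {A : Set} → Enumeration A → ∀ k → Enumeration (Vec A k)
vecEnumeration enum zero = record { elements = [] ∷ [] ; complete = λ { [] → here refl } }
vecEnumeration enum (suc k) = record
  { elements = cartesianProductWith _∷_ (elements enum) (elements (vecEnumeration enum k))
  ; complete = λ { (x ∷ xs) →
      ∈-cartesianProductWith⁺ _∷_ (complete enum x) (complete (vecEnumeration enum k) xs) } }

lookup-injective : ∀ {A : Set} {xs : List A} → UniqueList.Unique xs →
                   ∀ i j → lookup xs i ≡ lookup xs j → i ≡ j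
lookup-injective (x∉xs ∷ u) zero    zero    eq = refl
lookup-injective (x∉xs ∷ u) zero    (suc j) eq = ⊥-elim (All.lookup x∉xs (∈-lookup j) eq)
lookup-injective (x∉xs ∷ u) (suc i) zero    eq = ⊥-elim (All.lookup x∉xs (∈-lookup i) (sym eq))
lookup-injective (x∉xs ∷ u) (suc i) (suc j) eq = cong suc (lookup-injective u i j eq)

unique-⊆⇒length≤ : ∀ {A : Set} {xs ys : List A} → UniqueList.Unique xs → xs ⊆ ys →
                   length xs ≤ length ys
unique-⊆⇒length≤ {A} {xs} {ys} u xs⊆ys = Fin.injective⇒≤ {f = position} position-injective
  where
  position : Fin (length xs) → Fin (length ys)
  position i = Any.index (xs⊆ys (∈-lookup i))

  position-injective : ∀ {i j} → position i ≡ position j → i ≡ j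
  position-injective {i} {j} eq =
    lookup-injective u i j (index-injective (setoid A) (xs⊆ys (∈-lookup i)) (xs⊆ys (∈-lookup j)) eq)

parity-suc : ∀ k → parity (suc k) ≡ parity k ⁻¹
parity-suc k = sym (ℙ.suc-homo-⁻¹ (suc k))

parity-m+[n+m] : ∀ m n → parity (m + (n + m)) ≡ parity n
parity-m+[n+m] m n = begin
  parity (m + (n + m))     ≡⟨ ℙ.+-homo-+ m (n + m) ⟩
  pm +ℙ parity (n + m)     ≡⟨ cong (pm +ℙ_) (trans (ℙ.+-homo-+ n m) (ℙ.+-comm pn pm)) ⟩
  pm +ℙ (pm +ℙ pn)         ≡⟨ sym (ℙ.+-assoc pm pm pn) ⟩
  (pm +ℙ pm) +ℙ pn         ≡⟨ cong (_+ℙ pn) (ℙ.p+p≡0ℙ pm) ⟩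
  pn                       ∎
  where
  open ≡-Reasoning
  pm = parity m
  pn = parity n

parity≡0ℙ⇒2∣ : ∀ n → parity n ≡ 0ℙ → 2 ∣ n
parity≡0ℙ⇒2∣ zero          _    = 2 ∣0
parity≡0ℙ⇒2∣ (suc (suc n)) even = ∣m∣n⇒∣m+n n∣n (parity≡0ℙ⇒2∣ n even)

∣2⇒∣odd⇒∣1 : ∀ {c} n → parity n ≡ 1ℙ → c ∣ 2 → c ∣ n → c ∣ 1
∣2⇒∣odd⇒∣1 (suc zero)    _   _   c∣1   = c∣1
∣2⇒∣odd⇒∣1 (suc (suc n)) odd c∣2 c∣2+n = ∣2⇒∣odd⇒∣1 n odd c∣2 (∣m+n∣m⇒∣n c∣2+n c∣2)

isGcdOf-1 : ∀ {S : ℕ → Set} {k} → S 2 → S k → parity k ≡ 1ℙ → IsGcdOf S 1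
isGcdOf-1 {k = k} s2 sk odd = (λ d _ → 1∣ d) , λ c c∣S → ∣2⇒∣odd⇒∣1 k odd (c∣S 2 s2) (c∣S k sk)

isGcdOf-2 : ∀ {S : ℕ → Set} → S 2 → (∀ d → S d → parity d ≡ 0ℙ) → IsGcdOf S 2
isGcdOf-2 s2 even = (λ d sd → parity≡0ℙ⇒2∣ d (even d sd)) , λ c c∣S → c∣S 2 s2

module FiniteGraph {X : Set} (_≟_ : DecidableEquality X) (vertexEnumeration : Enumeration X)
                   (E : X → X → Set) (E? : ∀ a b → Dec (E a b)) where

  infixl 5 _▻_

  data Walk (a : X) : ℕ → X → Set where
    []  : Walk a zero a
    _▻_ : ∀ {k v w} → Walk a k v → E v w → Walk a (suc k) w

  vertices : ∀ {a k b} → Walk a k b → List X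
  vertices {a} []         = a ∷ []
  vertices {b = w} (p ▻ _) = w ∷ vertices p

  length-vertices : ∀ {a k b} (p : Walk a k b) → length (vertices p) ≡ suc k
  length-vertices []      = refl
  length-vertices (p ▻ _) = cong suc (length-vertices p)

  Path : X → X → Set
  Path a b = ∃[ k ] Σ (Walk a k b) λ p → UniqueList.Unique (vertices p)

  prefix : ∀ {a k v w} (p : Walk a k v) → UniqueList.Unique (vertices p) → w ∈ vertices p →
           Path a w
  prefix []      _       (here refl) = _ , [] , All.[] ∷ []
  prefix (p ▻ e) u       (here refl) = _ , p ▻ e , u
  prefix (p ▻ e) (_ ∷ u) (there w∈p) = prefix p u w∈p

  open DecMembership _≟_ using (_∈?_)

  loopErase : ∀ {a k b} → Walk a k b → Path a b
  loopErase []              = _ , [] , All.[] ∷ []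
  loopErase {b = w} (p ▻ e) with loopErase p
  ... | _ , q , u with w ∈? vertices q
  ...   | yes w∈q = prefix q u w∈q
  ...   | no  w∉q = _ , q ▻ e , ¬Any⇒All¬ (vertices q) w∉q ∷ u

  shorten : ∀ {a k b} → Walk a k b → ∃[ k′ ] (k′ < length (elements vertexEnumeration) × Walk a k′ b)
  shorten p with loopErase p
  ... | k′ , q , u = k′ , bound , q
    where
    bound : suc k′ ≤ length (elements vertexEnumeration)
    bound = subst (_≤ _) (length-vertices q)
                  (unique-⊆⇒length≤ u (λ {x} _ → complete vertexEnumeration x))

  walk? : ∀ a k b → Dec (Walk a k b)
  walk? a zero b = map′ (λ { refl → [] }) (λ { [] → refl }) (a ≟ b)
  walk? a (suc k) b =
    map′ (λ (_ , p , e) → p ▻ e) (λ { (p ▻ e) → _ , p , e })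
         (∃? vertexEnumeration λ v → walk? a k v ×-dec E? v b)

  reachable? : ∀ a b → Dec (∃[ k ] Walk a k b)
  reachable? a b =
    map′ (λ (k , _ , p) → k , p) (λ (_ , p) → shorten p)
         (ℕ.anyUpTo? (λ k → walk? a k b) (length (elements vertexEnumeration)))

module ParityDoubleCover {X : Set} (_≟_ : DecidableEquality X) (vertexEnumeration : Enumeration X)
                         (E : X → X → Set) (E? : ∀ a b → Dec (E a b)) where

  open FiniteGraph _≟_ vertexEnumeration E E?

  CoverEdge : X × Parity → X × Parity → Set
  CoverEdge (v , p) (w , q) = E v w × q ≡ p ⁻¹

  module Cover = FiniteGraph (Product.≡-dec _≟_ ℙ._≟_)
                             (×-enumeration vertexEnumeration parityEnumeration)
                             CoverEdge (λ (v , p) (w , q) → E? v w ×-dec q ℙ.≟ p ⁻¹)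

  lift : ∀ {a k b} → Walk a k b → Cover.Walk (a , 0ℙ) k (b , parity k)
  lift []                = Cover.[]
  lift (_▻_ {k = k} p e) = lift p Cover.▻ (e , parity-suc k)

  project : ∀ {a k b p} → Cover.Walk (a , 0ℙ) k (b , p) → Walk a k b × parity k ≡ p
  project Cover.[] = [] , refl
  project (Cover._▻_ {k = k} w (e , refl)) with project w
  ... | p , refl = p ▻ e , parity-suc k

  walkOfParity? : ∀ a b p → Dec (∃[ k ] (parity k ≡ p × Walk a k b))
  walkOfParity? a b p =
    map′ (λ (k , w) → let (q , parity≡p) = project w in k , parity≡p , q)
         (λ { (k , refl , q) → k , lift q })
         (Cover.reachable? (a , 0ℙ) (b , p))

module Diagonals {n : ℕ} (_*_ : Fin n → Fin n → Fin n) where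

  infixl 5 _▷▷_

  _▷▷_ : ∀ {U V W a b} → Diagonal _*_ U a V → Diagonal _*_ V b W → Diagonal _*_ U (b + a) W
  D ▷▷ []             = D
  D ▷▷ (D′ ▷ W ∣ uW) = (D ▷▷ D′) ▷ W ∣ uW

  prepend : ∀ {U V a} W → IsPermTuple W → Diagonal _*_ (U ⊛[ _*_ ] W) a V → Diagonal _*_ U (suc a) V
  prepend W uW []             = [] ▷ W ∣ uW
  prepend W uW (D ▷ W′ ∣ uW′) = prepend W uW D ▷ W′ ∣ uW′

  Step : Tuple n → Tuple n → Set
  Step V V′ = Σ (Tuple n) λ W → IsPermTuple W × V ⊛[ _*_ ] W ≡ V′

  tupleEnumeration : Enumeration (Tuple n)
  tupleEnumeration = vecEnumeration (finEnumeration n) n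

  _≟ᵗ_ : DecidableEquality (Tuple n)
  _≟ᵗ_ = Vec.≡-dec Fin._≟_

  step? : ∀ V V′ → Dec (Step V V′)
  step? V V′ = ∃? tupleEnumeration λ W →
    allPairs? (λ x y → ¬? (x Fin.≟ y)) W ×-dec (V ⊛[ _*_ ] W) ≟ᵗ V′

  open FiniteGraph _≟ᵗ_ tupleEnumeration Step step?
  open ParityDoubleCover _≟ᵗ_ tupleEnumeration Step step?

  diagonal⇒walk : ∀ {U k V} → Diagonal _*_ U k V → Walk U k V
  diagonal⇒walk []           = []
  diagonal⇒walk (D ▷ W ∣ uW) = diagonal⇒walk D ▻ (W , uW , refl)

  walk⇒diagonal : ∀ {U k V} → Walk U k V → Diagonal _*_ U k V
  walk⇒diagonal []                    = []
  walk⇒diagonal (p ▻ (W , uW , refl)) = walk⇒diagonal p ▷ W ∣ uW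

  ClosedDiagonalOfParity : Tuple n → Parity → Set
  ClosedDiagonalOfParity U p = ∃[ k ] (parity k ≡ p × Diagonal _*_ U k U)

  closedDiagonalOfParity? : ∀ U p → Dec (ClosedDiagonalOfParity U p)
  closedDiagonalOfParity? U p =
    map′ (λ (k , parity≡p , w) → k , parity≡p , walk⇒diagonal w)
         (λ (k , parity≡p , D) → k , parity≡p , diagonal⇒walk D)
         (walkOfParity? U U p)

zipWith-rightInverse : ∀ {n m} (_*_ : Fin n → Fin n → Fin n) (π : Fin n → Fin n) →
                       (∀ g h → (g * h) * π h ≡ g) →
                       (V W : Vec (Fin n) m) → zipWith _*_ (zipWith _*_ V W) (map π W) ≡ V
zipWith-rightInverse _*_ π rip []      []      = refl
zipWith-rightInverse _*_ π rip (v ∷ V) (w ∷ W) =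
  cong₂ _∷_ (rip v w) (zipWith-rightInverse _*_ π rip V W)

module RightInverseDiagonals {n : ℕ} (_*_ : Fin n → Fin n → Fin n) (π : Permutation′ n)
                             (rip : ∀ g h → (g * h) * (π ⟨$⟩ʳ h) ≡ g) where

  open Diagonals _*_

  π-tuple : Tuple n → Tuple n
  π-tuple = map (π ⟨$⟩ʳ_)

  π-tuple-isPermTuple : ∀ {W} → IsPermTuple W → IsPermTuple (π-tuple W)
  π-tuple-isPermTuple = map⁺ (Injection.injective (↔⇒↣ π))

  undo-step : ∀ V W → (V ⊛[ _*_ ] W) ⊛[ _*_ ] π-tuple W ≡ V
  undo-step = zipWith-rightInverse _*_ (π ⟨$⟩ʳ_) rip

  reverse : ∀ {U a V} → Diagonal _*_ U a V → Diagonal _*_ V a U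
  reverse []                     = []
  reverse {U} (_▷_∣_ {V = V} D W uW) =
    prepend (π-tuple W) (π-tuple-isPermTuple uW)
            (subst (λ X → Diagonal _*_ X _ U) (sym (undo-step V W)) (reverse D))

  identity-tuple : Tuple n
  identity-tuple = allFin n

  returnLength-2 : ∀ U → ReturnLength _*_ U 2
  returnLength-2 U = s≤s z≤n , U , (0 , []) , step ▷▷ reverse step
    where
    step : Diagonal _*_ U 1 (U ⊛[ _*_ ] identity-tuple)
    step = [] ▷ identity-tuple ∣ tabulate⁺ (λ eq → eq)

  oddCycle⇒returnLength : ∀ {U k} → parity k ≡ 1ℙ → Diagonal _*_ U k U → ReturnLength _*_ U k
  oddCycle⇒returnLength {k = suc _} _ cycle = s≤s z≤n , _ , (0 , []) , cycle

  returnLength⇒closedDiagonal : ∀ {U d} → ReturnLength _*_ U d →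
                                ClosedDiagonalOfParity U (parity d)
  returnLength⇒closedDiagonal {d = d} (_ , _ , (a , D) , C) =
    a + (d + a) , parity-m+[n+m] a d , D ▷▷ C ▷▷ reverse D

  returnLength-even : ∀ {U} → ¬ ClosedDiagonalOfParity U 1ℙ →
                      ∀ d → ReturnLength _*_ U d → parity d ≡ 0ℙ
  returnLength-even noOddCycle d returns with parity d in parity≡
  ... | 0ℙ = refl
  ... | 1ℙ = ⊥-elim (noOddCycle
                (subst (ClosedDiagonalOfParity _) parity≡ (returnLength⇒closedDiagonal returns)))

proposition6 : (n : ℕ) (_*_ : Fin n → Fin n → Fin n) →
    IsQuasigroup n _*_ → HasRightInverseProperty n _*_ →
    (U : Tuple n) → ∃[ p ] (HasPeriod _*_ U p × (p ≡ 1 ⊎ p ≡ 2))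
proposition6 n _*_ _ (π , rip) U = period (closedDiagonalOfParity? U 1ℙ)
  where
  open Diagonals _*_
  open RightInverseDiagonals _*_ π rip

  period : Dec (ClosedDiagonalOfParity U 1ℙ) →
           ∃[ p ] (HasPeriod _*_ U p × (p ≡ 1 ⊎ p ≡ 2))
  period (yes (k , odd , cycle)) =
    1 , isGcdOf-1 (returnLength-2 U) (oddCycle⇒returnLength odd cycle) odd , inj₁ refl
  period (no noOddCycle) =
    2 , isGcdOf-2 (returnLength-2 U) (returnLength-even noOddCycle) , inj₂ refl
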